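{- Let $n\ge 1$. Define numbers $m^{\ell}_{A,k}$ for $1\le \ell\le n$, $A\subseteq[n]$ and $1\le k\le n+1$ by $m^1_{A,k}=1$ for all $(A,k)$ and, for $1<\ell\le n$, \[m^{\ell}_{A,k}=\sum_{B\subseteq A}\ \sum_{i=p(A,B,k)}^{q(A,B,k)} m^{\ell-1}_{B,i},\] where \[p(A,B,k)=\max\big(\{j\in[n+1]: j<k,\ j\notin A,\ j-1\in B\}\cup\{1\}\big),\quad q(A,B,k)=\min\big(\{j\in[n+1]: j>k,\ j\in B,\ j-1\notin A\}\cup\{n+1\}\big).\] Then the number $K(n)$ of maximum arrangements of nonattacking kings on the $2n\times 2n$ chessboard, i.e. the number of ways to place $n^2$ pairwise nonattacking kings on the $2n\times 2n$ board, equals \[K(n)=\sum_{A\subseteq[n]}\ \sum_{k=1}^{n+1} m^{n}_{A,k}.\]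
   Context: Two kings attack each other if their cells are distinct and adjacent horizontally, vertically or diagonally. The maximum number of pairwise nonattacking kings on a $2n\times 2n$ board is $n^2$; arrangements are counted as fixed placements (rotations and reflections are distinct). Here $[n]=\{1,\dots,n\}$ and $[n+1]=\{1,\dots,n+1\}$. -}

module Defs where

open import Data.Nat using (ℕ; zero; suc; _+_; _*_; _∸_; _≤_; _<_; _⊔_; _⊓_; ∣_-_∣)
open import Data.Bool using (Bool; true; false; _∧_; not; if_then_else_)
open import Data.Fin using (Fin; toℕ)
open import Data.Vec using (Vec; []; _∷_; lookup; replicate)
open import Data.List using (List; []; _∷_; _++_; map; upTo; foldr)
open import Data.Nat.ListAction using (sum)
open import Data.Product using (_×_)
open import Data.Empty using (⊥)
open import Relation.Binary.PropositionalEquality using (_≡_; _≢_)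
open import Relation.Nullary using (¬_)
open import Data.Fin.Subset using (Subset)

Board : ℕ → Set
Board n = Vec (Vec Bool (2 * n)) (2 * n)

Occupied : (n : ℕ) → Board n → Fin (2 * n) → Fin (2 * n) → Set
Occupied n M i j = lookup (lookup M i) j ≡ true

Attacking : ∀ {N} → Fin N → Fin N → Fin N → Fin N → Set
Attacking i j i' j' =
  ¬ (i ≡ i' × j ≡ j') × ∣ toℕ i - toℕ i' ∣ ≤ 1 × ∣ toℕ j - toℕ j' ∣ ≤ 1

NonAttacking : (n : ℕ) → Board n → Set
NonAttacking n M = (i j i' j' : Fin (2 * n)) → Attacking i j i' j' →
                   Occupied n M i j → Occupied n M i' j' → ⊥

countTrue : ∀ {m} → Vec Bool m → ℕ
countTrue [] = 0
countTrue (true ∷ v) = suc (countTrue v)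
countTrue (false ∷ v) = countTrue v

kingCount : ∀ {N m} → Vec (Vec Bool m) N → ℕ
kingCount [] = 0
kingCount (r ∷ M) = countTrue r + kingCount M

MaxArrangement : (n : ℕ) → Board n → Set
MaxArrangement n M = kingCount M ≡ n * n × NonAttacking n M

-- A ⊆ [n] is a Subset n; element j ∈ [n] corresponds to index j-1.
-- memℕ A j is true iff the natural number j belongs to A ⊆ [n]
-- (so always false for j = 0 or j > n).
memℕ : ∀ {n} → Subset n → ℕ → Bool
memℕ [] j = false
memℕ (b ∷ A) zero = false
memℕ (b ∷ A) (suc zero) = b
memℕ (b ∷ A) (suc (suc j)) = memℕ A (suc j)

subsetsOf : ∀ {n} → Subset n → List (Subset n)
subsetsOf [] = [] ∷ []
subsetsOf (true ∷ A) = map (true ∷_) (subsetsOf A) ++ map (false ∷_) (subsetsOf A)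
subsetsOf (false ∷ A) = map (false ∷_) (subsetsOf A)

allSubsets : (n : ℕ) → List (Subset n)
allSubsets n = subsetsOf (replicate n true)

range : ℕ → ℕ → List ℕ
range a b = map (a +_) (upTo (suc b ∸ a))

_<ᵇ′_ : ℕ → ℕ → Bool
zero <ᵇ′ zero = false
zero <ᵇ′ suc n = true
suc m <ᵇ′ zero = false
suc m <ᵇ′ suc n = m <ᵇ′ n

pIdx : ∀ {n} → Subset n → Subset n → ℕ → ℕ
pIdx {n} A B k =
  foldr (λ j acc → if (j <ᵇ′ k) ∧ not (memℕ A j) ∧ memℕ B (j ∸ 1)
                   then j ⊔ acc else acc)
        1 (range 1 (suc n))

qIdx : ∀ {n} → Subset n → Subset n → ℕ → ℕ
qIdx {n} A B k =
  foldr (λ j acc → if (k <ᵇ′ j) ∧ memℕ B j ∧ not (memℕ A (j ∸ 1))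
                   then j ⊓ acc else acc)
        (suc n) (range 1 (suc n))

-- mAux n l A k = m^{l+1}_{A,k}  (so that ℓ = 1 is the base case)
mAux : (n : ℕ) → ℕ → Subset n → ℕ → ℕ
mAux n zero A k = 1
mAux n (suc l) A k =
  sum (map (λ B → sum (map (λ i → mAux n l B i) (range (pIdx A B k) (qIdx A B k))))
           (subsetsOf A))

m : (n ℓ : ℕ) → Subset n → ℕ → ℕ
m n ℓ A k = mAux n (ℓ ∸ 1) A k

kingFormula : ℕ → ℕ
kingFormula n = sum (map (λ A → sum (map (λ k → m n n A k) (range 1 (suc n))))
                         (allSubsets n))

module Submission where

open import Defs
open import Data.Bool using (Bool; true; false; T; _∧_; _∨_; not; if_then_else_)
open import Data.Bool.Properties using (_≟_; T-≡; T-not-≡; T-∧)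
open import Data.Empty using (⊥; ⊥-elim)
open import Data.Fin using (Fin; toℕ; fromℕ<)
open import Data.Fin.Properties using (+↔⊎; toℕ-fromℕ<; toℕ-injective; toℕ<n)
open import Data.Fin.Subset using (Subset)
open import Data.Irrelevant using ([_])
open import Data.List using (List; []; _∷_; _++_; map; applyUpTo; upTo; foldr)
open import Data.List.Membership.Propositional using (_∈_)
open import Data.List.Membership.Propositional.Properties using (∈-map⁺; ∈-upTo⁺)
open import Data.List.Properties using (map-++; map-∘; map-applyUpTo)
open import Data.List.Relation.Unary.Any using (here; there)
open import Data.Nat hiding (_≟_)
open import Data.Nat.ListAction using (sum)
open import Data.Nat.ListAction.Properties using (sum-++)
open import Data.Nat.Properties hiding (_≟_)
open import Algebra.Properties.CommutativeSemigroup +-commutativeSemigroup using (interchange)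
import Data.Nat.Properties as ℕ
open import Data.Product using (Σ-syntax; _×_; _,_; proj₁; proj₂)
open import Data.Product.Function.Dependent.Propositional using (Σ-↔)
import Data.Product.Properties as Product
open import Data.Refinement using (Refinement-syntax; value; _,_)
open import Data.Refinement.Properties using (value-injective)
open import Data.Sum using (_⊎_; inj₁; inj₂)
open import Data.Sum.Function.Propositional using (_⊎-↔_)
open import Data.Unit using (⊤; tt)
open import Data.Vec using (Vec; []; _∷_; replicate; lookup)
import Data.Vec.Properties as Vec
open import Function.Base using (_∘_)
open import Function.Bundles using (_↔_; mk↔ₛ′; Equivalence)
open import Function.Properties.Inverse using (↔-refl; ↔-trans)
open import Function.Related.Propositional using (module EquationalReasoning)
open import Relation.Binary.PropositionalEquality
  using (_≡_; refl; sym; trans; cong; cong₂; subst; subst₂; module ≡-Reasoning)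
open import Relation.Nullary using (¬_; yes; no; does)
open import Relation.Nullary.Decidable using (recompute; dec-true)

-- Cut the 2n × 2n board into n² blocks of size 2 × 2. Two kings in one block attack each
-- other, so a placement of n² nonattacking kings has exactly one king in every block. For
-- block row I record the set A ⊆ [n] of blocks whose king lies in the lower half, and the
-- index k ∈ [n+1] such that exactly the first k − 1 blocks have their king in the left half:
-- a right-half king directly followed by a left-half king would attack it, so the left-half
-- kings form a prefix. Kings in one block row are then apart, and the kings of block rows
-- I and I+1, with states (B, i) and (A, k), are apart exactly when B ⊆ A and
-- p(A,B,k) ≤ i ≤ q(A,B,k). So maximum arrangements are the sequences of n states in which
-- consecutive states are compatible in this sense, and unfolding the recursion for m^ℓ_{A,k}
-- from the bottom block row upwards counts exactly these sequences.

Fin-cong : ∀ {m n} → m ≡ n → Fin m ↔ Fin n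
Fin-cong refl = ↔-refl

Below : ℕ → Set
Below m = [ t ∈ ℕ ∣ t < m ]

Between : ℕ → ℕ → Set
Between a b = [ i ∈ ℕ ∣ a ≤ i × i ≤ b ]

Fin-sum-applyUpTo↔ : ∀ m (f : ℕ → ℕ) →
  Fin (sum (applyUpTo f m)) ↔ (Σ[ t ∈ Below m ] Fin (f (value t)))
Fin-sum-applyUpTo↔ zero f = mk↔ₛ′ (λ ()) (λ { ((_ , [ () ]) , _) }) (λ { ((_ , [ () ]) , _) }) (λ ())
Fin-sum-applyUpTo↔ (suc m) f = begin
  Fin (f 0 + sum (applyUpTo (f ∘ suc) m))                    ↔⟨ +↔⊎ ⟩
  (Fin (f 0) ⊎ Fin (sum (applyUpTo (f ∘ suc) m)))             ↔⟨ ↔-refl ⊎-↔ Fin-sum-applyUpTo↔ m (f ∘ suc) ⟩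
  (Fin (f 0) ⊎ (Σ[ t ∈ Below m ] Fin (f (suc (value t)))))   ↔⟨ peel ⟩
  (Σ[ t ∈ Below (suc m) ] Fin (f (value t)))                 ∎
  where
  open EquationalReasoning
  peel : (Fin (f 0) ⊎ (Σ[ t ∈ Below m ] Fin (f (suc (value t))))) ↔ (Σ[ t ∈ Below (suc m) ] Fin (f (value t)))
  peel = mk↔ₛ′ to from (λ { ((zero , _) , x) → refl ; ((suc t , _) , x) → refl })
                      (λ { (inj₁ _) → refl ; (inj₂ _) → refl })
    where
    to : Fin (f 0) ⊎ (Σ[ t ∈ Below m ] Fin (f (suc (value t)))) → Σ[ t ∈ Below (suc m) ] Fin (f (value t))
    to (inj₁ x)                    = (0 , [ z<s ]) , x
    to (inj₂ ((t , [ t<m ]) , x)) = (suc t , [ s<s t<m ]) , x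
    from : (Σ[ t ∈ Below (suc m) ] Fin (f (value t))) → Fin (f 0) ⊎ (Σ[ t ∈ Below m ] Fin (f (suc (value t))))
    from ((zero , _) , x)           = inj₁ x
    from ((suc t , [ t<m ]) , x)   = inj₂ ((t , [ s<s⁻¹ t<m ]) , x)

<∸⇒+≤ : ∀ a b {t} → t < suc b ∸ a → a + t ≤ b
<∸⇒+≤ zero    b           t<n = s≤s⁻¹ t<n
<∸⇒+≤ (suc a) zero    {t} t<n = ⊥-elim (n≮0 (subst (t <_) (0∸n≡0 a) t<n))
<∸⇒+≤ (suc a) (suc b)     t<n = s≤s (<∸⇒+≤ a b t<n)

Below↔Between : ∀ a b → Below (suc b ∸ a) ↔ Between a b
Below↔Between a b = mk↔ₛ′
  (λ { (t , [ t<n ]) → a + t , [ m≤m+n a t , <∸⇒+≤ a b t<n ] })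
  (λ { (i , [ a≤i≤b ]) → i ∸ a , [ ∸-monoˡ-< (s≤s (proj₂ a≤i≤b)) (proj₁ a≤i≤b) ] })
  (λ { (i , [ a≤i≤b ]) → value-injective (m+[n∸m]≡n (recompute (a ≤? i) (proj₁ a≤i≤b))) })
  (λ { (t , _) → value-injective (m+n∸m≡n a t) })

Fin-sum-range↔ : ∀ a b (f : ℕ → ℕ) →
  Fin (sum (map f (range a b))) ↔ (Σ[ i ∈ Between a b ] Fin (f (value i)))
Fin-sum-range↔ a b f = begin
  Fin (sum (map f (range a b)))                       ≡⟨ cong (Fin ∘ sum) map-range ⟩
  Fin (sum (applyUpTo (f ∘ (a +_)) (suc b ∸ a)))      ↔⟨ Fin-sum-applyUpTo↔ (suc b ∸ a) (f ∘ (a +_)) ⟩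
  (Σ[ t ∈ Below (suc b ∸ a) ] Fin (f (a + value t)))  ↔⟨ Σ-↔ (Below↔Between a b) ↔-refl ⟩
  (Σ[ i ∈ Between a b ] Fin (f (value i)))            ∎
  where
  open EquationalReasoning
  map-range : map f (range a b) ≡ applyUpTo (f ∘ (a +_)) (suc b ∸ a)
  map-range = trans (sym (map-∘ (upTo (suc b ∸ a)))) (map-applyUpTo (λ t → t) (f ∘ (a +_)) (suc b ∸ a))

_⊆ᵇ_ : ∀ {n} → Subset n → Subset n → Bool
[]          ⊆ᵇ []      = true
(false ∷ B) ⊆ᵇ (_ ∷ A) = B ⊆ᵇ A
(true ∷ B)  ⊆ᵇ (a ∷ A) = a ∧ (B ⊆ᵇ A)

SubsetOf : ∀ {n} → Subset n → Set
SubsetOf {n} A = [ B ∈ Subset n ∣ T (B ⊆ᵇ A) ]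

module _ {n} (A : Subset n) (P : Subset (suc n) → Set) where

  Σ-SubsetOf-false∷↔ : (Σ[ B ∈ SubsetOf A ] P (false ∷ value B)) ↔ (Σ[ B ∈ SubsetOf (false ∷ A) ] P (value B))
  Σ-SubsetOf-false∷↔ = mk↔ₛ′ to from (λ { ((false ∷ _ , _) , _) → refl ; ((true ∷ _ , [ () ]) , _) })
                                      (λ _ → refl)
    where
    to : (Σ[ B ∈ SubsetOf A ] P (false ∷ value B)) → Σ[ B ∈ SubsetOf (false ∷ A) ] P (value B)
    to ((B , [ B⊆A ]) , x) = (false ∷ B , [ B⊆A ]) , x
    from : (Σ[ B ∈ SubsetOf (false ∷ A) ] P (value B)) → Σ[ B ∈ SubsetOf A ] P (false ∷ value B)
    from ((false ∷ B , [ B⊆A ]) , x) = (B , [ B⊆A ]) , x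
    from ((true ∷ _ , [ () ]) , _)

  Σ-SubsetOf-true∷↔ : ((Σ[ B ∈ SubsetOf A ] P (true ∷ value B)) ⊎ (Σ[ B ∈ SubsetOf A ] P (false ∷ value B)))
                     ↔ (Σ[ B ∈ SubsetOf (true ∷ A) ] P (value B))
  Σ-SubsetOf-true∷↔ = mk↔ₛ′ to from (λ { ((true ∷ _ , _) , _) → refl ; ((false ∷ _ , _) , _) → refl })
                                     (λ { (inj₁ _) → refl ; (inj₂ _) → refl })
    where
    to : (Σ[ B ∈ SubsetOf A ] P (true ∷ value B)) ⊎ (Σ[ B ∈ SubsetOf A ] P (false ∷ value B))
       → Σ[ B ∈ SubsetOf (true ∷ A) ] P (value B)
    to (inj₁ ((B , [ B⊆A ]) , x)) = (true ∷ B , [ B⊆A ]) , x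
    to (inj₂ ((B , [ B⊆A ]) , x)) = (false ∷ B , [ B⊆A ]) , x
    from : (Σ[ B ∈ SubsetOf (true ∷ A) ] P (value B))
         → (Σ[ B ∈ SubsetOf A ] P (true ∷ value B)) ⊎ (Σ[ B ∈ SubsetOf A ] P (false ∷ value B))
    from ((true ∷ B , [ B⊆A ]) , x)  = inj₁ ((B , [ B⊆A ]) , x)
    from ((false ∷ B , [ B⊆A ]) , x) = inj₂ ((B , [ B⊆A ]) , x)

sum-map-∘ : ∀ {A B : Set} (f : B → ℕ) (g : A → B) xs → sum (map f (map g xs)) ≡ sum (map (f ∘ g) xs)
sum-map-∘ f g xs = cong sum (sym (map-∘ xs))

Fin-sum-subsetsOf↔ : ∀ {n} (A : Subset n) (f : Subset n → ℕ) →
  Fin (sum (map f (subsetsOf A))) ↔ (Σ[ B ∈ SubsetOf A ] Fin (f (value B)))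
Fin-sum-subsetsOf↔ [] f = ↔-trans (Fin-cong (+-identityʳ (f [])))
  (mk↔ₛ′ (λ x → ([] , [ tt ]) , x) (λ { (([] , _) , x) → x }) (λ { (([] , _) , _) → refl }) (λ _ → refl))
Fin-sum-subsetsOf↔ (false ∷ A) f = begin
  Fin (sum (map f (map (false ∷_) (subsetsOf A))))    ≡⟨ cong Fin (sum-map-∘ f (false ∷_) (subsetsOf A)) ⟩
  Fin (sum (map (f ∘ (false ∷_)) (subsetsOf A)))      ↔⟨ Fin-sum-subsetsOf↔ A (f ∘ (false ∷_)) ⟩
  (Σ[ B ∈ SubsetOf A ] Fin (f (false ∷ value B)))      ↔⟨ Σ-SubsetOf-false∷↔ A (Fin ∘ f) ⟩
  (Σ[ B ∈ SubsetOf (false ∷ A) ] Fin (f (value B)))   ∎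
  where open EquationalReasoning
Fin-sum-subsetsOf↔ (true ∷ A) f = begin
  Fin (sum (map f (map (true ∷_) S ++ map (false ∷_) S)))
    ≡⟨ cong Fin split ⟩
  Fin (sum (map (f ∘ (true ∷_)) S) + sum (map (f ∘ (false ∷_)) S))
    ↔⟨ +↔⊎ ⟩
  (Fin (sum (map (f ∘ (true ∷_)) S)) ⊎ Fin (sum (map (f ∘ (false ∷_)) S)))
    ↔⟨ Fin-sum-subsetsOf↔ A (f ∘ (true ∷_)) ⊎-↔ Fin-sum-subsetsOf↔ A (f ∘ (false ∷_)) ⟩
  ((Σ[ B ∈ SubsetOf A ] Fin (f (true ∷ value B))) ⊎ (Σ[ B ∈ SubsetOf A ] Fin (f (false ∷ value B))))
    ↔⟨ Σ-SubsetOf-true∷↔ A (Fin ∘ f) ⟩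
  (Σ[ B ∈ SubsetOf (true ∷ A) ] Fin (f (value B)))
    ∎
  where
  open EquationalReasoning
  S = subsetsOf A
  split : sum (map f (map (true ∷_) S ++ map (false ∷_) S))
        ≡ sum (map (f ∘ (true ∷_)) S) + sum (map (f ∘ (false ∷_)) S)
  split = trans (cong sum (map-++ f (map (true ∷_) S) (map (false ∷_) S)))
         (trans (sum-++ (map f (map (true ∷_) S)) (map f (map (false ∷_) S)))
                (cong₂ _+_ (sum-map-∘ f (true ∷_) S) (sum-map-∘ f (false ∷_) S)))

lookupℕ : ∀ {A : Set} {m} → A → Vec A m → ℕ → A
lookupℕ d []       _       = d
lookupℕ d (x ∷ xs) zero    = x
lookupℕ d (x ∷ xs) (suc i) = lookupℕ d xs i

tabulateℕ : ∀ {A : Set} m → (ℕ → A) → Vec A m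
tabulateℕ zero    f = []
tabulateℕ (suc m) f = f 0 ∷ tabulateℕ m (f ∘ suc)

module _ {A : Set} (d : A) where

  lookup≡lookupℕ : ∀ {m} (xs : Vec A m) (a : Fin m) → lookup xs a ≡ lookupℕ d xs (toℕ a)
  lookup≡lookupℕ (x ∷ xs) Fin.zero    = refl
  lookup≡lookupℕ (x ∷ xs) (Fin.suc a) = lookup≡lookupℕ xs a

  lookupℕ-tabulateℕ : ∀ {m} (f : ℕ → A) {i} → i < m → lookupℕ d (tabulateℕ m f) i ≡ f i
  lookupℕ-tabulateℕ {suc m} f {zero}  _         = refl
  lookupℕ-tabulateℕ {suc m} f {suc i} (s<s i<m) = lookupℕ-tabulateℕ (f ∘ suc) i<m

  lookupℕ-ext : ∀ {m} (xs ys : Vec A m) → (∀ {i} → i < m → lookupℕ d xs i ≡ lookupℕ d ys i) → xs ≡ ys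
  lookupℕ-ext []       []       _  = refl
  lookupℕ-ext (x ∷ xs) (y ∷ ys) eq = cong₂ _∷_ (eq z<s) (lookupℕ-ext xs ys (eq ∘ s<s))

memℕ≡lookupℕ : ∀ {n} (A : Subset n) J → memℕ A (suc J) ≡ lookupℕ false A J
memℕ≡lookupℕ []      J       = refl
memℕ≡lookupℕ (_ ∷ _) zero    = refl
memℕ≡lookupℕ (_ ∷ A) (suc J) = memℕ≡lookupℕ A J

-- Chains of block-row states

State : ℕ → Set
State n = Subset n × ℕ

record Compatible {n} (upper lower : State n) : Set where
  constructor compatible
  field
    subset  : T (proj₁ upper ⊆ᵇ proj₁ lower)
    bounded : pIdx (proj₁ lower) (proj₁ upper) (proj₂ lower) ≤ proj₂ upper ×
              proj₂ upper ≤ qIdx (proj₁ lower) (proj₁ upper) (proj₂ lower)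

IsChain : ∀ {n l} → State n → Vec (State n) l → Set
IsChain s []       = ⊤
IsChain s (s′ ∷ w) = Compatible s′ s × IsChain s′ w

Chain : ∀ n l → State n → Set
Chain n l s = [ w ∈ Vec (State n) l ∣ IsChain s w ]

mAux↔Chain : ∀ {n} l (A : Subset n) k → Fin (mAux n l A k) ↔ Chain n l (A , k)
mAux↔Chain zero A k =
  mk↔ₛ′ (λ _ → [] , [ tt ]) (λ _ → Fin.zero) (λ { ([] , _) → refl }) (λ { Fin.zero → refl ; (Fin.suc ()) })
mAux↔Chain {n} (suc l) A k = begin
  Fin (mAux n (suc l) A k)
    ↔⟨ Fin-sum-subsetsOf↔ A _ ⟩
  (Σ[ B ∈ SubsetOf A ] Fin (sum (map (mAux n l (value B)) (range (p B) (q B)))))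
    ↔⟨ Σ-↔ ↔-refl (Fin-sum-range↔ _ _ _) ⟩
  (Σ[ B ∈ SubsetOf A ] Σ[ i ∈ Between (p B) (q B) ] Fin (mAux n l (value B) (value i)))
    ↔⟨ Σ-↔ ↔-refl (Σ-↔ ↔-refl (mAux↔Chain l _ _)) ⟩
  (Σ[ B ∈ SubsetOf A ] Σ[ i ∈ Between (p B) (q B) ] Chain n l (value B , value i))
    ↔⟨ mk↔ₛ′ cons uncons (λ { ((_ ∷ _) , _) → refl }) (λ _ → refl) ⟩
  Chain n (suc l) (A , k)
    ∎
  where
  open EquationalReasoning
  p q : SubsetOf A → ℕ
  p B = pIdx A (value B) k
  q B = qIdx A (value B) k
  cons : (Σ[ B ∈ SubsetOf A ] Σ[ i ∈ Between (p B) (q B) ] Chain n l (value B , value i)) → Chain n (suc l) (A , k)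
  cons ((B , [ B⊆A ]) , (i , [ p≤i≤q ]) , (w , [ chain ])) = (B , i) ∷ w , [ compatible B⊆A p≤i≤q , chain ]
  uncons : Chain n (suc l) (A , k) → Σ[ B ∈ SubsetOf A ] Σ[ i ∈ Between (p B) (q B) ] Chain n l (value B , value i)
  uncons ((B , i) ∷ w , [ chain ]) =
    (B , [ Compatible.subset (proj₁ chain) ]) , (i , [ Compatible.bounded (proj₁ chain) ]) , (w , [ proj₂ chain ])

IsColumn : ∀ {n l} → Vec (State n) l → Set
IsColumn     []            = ⊤
IsColumn {n} ((A , k) ∷ w) = (1 ≤ k × k ≤ suc n) × IsChain (A , k) w

Column : ℕ → Set
Column n = [ v ∈ Vec (State n) n ∣ IsColumn v ]

kingFormula↔Column : ∀ n → Fin (kingFormula (suc n)) ↔ Column (suc n)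
kingFormula↔Column n = begin
  Fin (kingFormula N)
    ↔⟨ Fin-sum-subsetsOf↔ (replicate N true) _ ⟩
  (Σ[ A ∈ SubsetOf (replicate N true) ] Fin (sum (map (m N N (value A)) (range 1 (suc N)))))
    ↔⟨ Σ-↔ ↔-refl (Fin-sum-range↔ _ _ _) ⟩
  (Σ[ A ∈ SubsetOf (replicate N true) ] Σ[ k ∈ Between 1 (suc N) ] Fin (m N N (value A) (value k)))
    ↔⟨ Σ-↔ ↔-refl (Σ-↔ ↔-refl (mAux↔Chain n _ _)) ⟩
  (Σ[ A ∈ SubsetOf (replicate N true) ] Σ[ k ∈ Between 1 (suc N) ] Chain N n (value A , value k))
    ↔⟨ mk↔ₛ′ cons uncons (λ { ((_ ∷ _) , _) → refl }) (λ _ → refl) ⟩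
  Column N
    ∎
  where
  open EquationalReasoning
  N = suc n
  cons : (Σ[ A ∈ SubsetOf (replicate N true) ] Σ[ k ∈ Between 1 (suc N) ] Chain N n (value A , value k)) → Column N
  cons ((A , _) , (k , [ 1≤k≤N+1 ]) , (w , [ chain ])) = (A , k) ∷ w , [ 1≤k≤N+1 , chain ]
  uncons : Column N → Σ[ A ∈ SubsetOf (replicate N true) ] Σ[ k ∈ Between 1 (suc N) ] Chain N n (value A , value k)
  uncons ((A , k) ∷ w , [ column ]) = (A , [ ⊆ᵇ-full A ]) , (k , [ proj₁ column ]) , (w , [ proj₂ column ])
    where
    ⊆ᵇ-full : ∀ {m} (A : Subset m) → T (A ⊆ᵇ replicate m true)
    ⊆ᵇ-full []          = tt
    ⊆ᵇ-full (false ∷ A) = ⊆ᵇ-full A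
    ⊆ᵇ-full (true ∷ A)  = ⊆ᵇ-full A

module _ {n} (d : State n) where

  isChain⇒compatible : ∀ {l} s (w : Vec (State n) l) → IsChain s w →
                       ∀ {t} → t < l → Compatible (lookupℕ d w t) (lookupℕ d (s ∷ w) t)
  isChain⇒compatible s (s′ ∷ w) (c , _)     {zero}  _         = c
  isChain⇒compatible s (s′ ∷ w) (_ , chain) {suc t} (s<s t<l) = isChain⇒compatible s′ w chain t<l

  compatible⇒isChain : ∀ {l} s (w : Vec (State n) l) →
                       (∀ {t} → t < l → Compatible (lookupℕ d w t) (lookupℕ d (s ∷ w) t)) → IsChain s w
  compatible⇒isChain s []       _ = tt
  compatible⇒isChain s (s′ ∷ w) c = c z<s , compatible⇒isChain s′ w (c ∘ s<s)

-- The extremal indices p and q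

maxWhere : (ℕ → Bool) → ℕ → List ℕ → ℕ
maxWhere P b = foldr (λ j acc → if P j then j ⊔ acc else acc) b

minWhere : (ℕ → Bool) → ℕ → List ℕ → ℕ
minWhere P b = foldr (λ j acc → if P j then j ⊓ acc else acc) b

module _ (P : ℕ → Bool) (b : ℕ) where

  ≤-maxWhere : ∀ {x xs} → x ∈ xs → T (P x) → x ≤ maxWhere P b xs
  ≤-maxWhere {xs = y ∷ xs} (here refl) Px with P y
  ... | true = m≤m⊔n y _
  ≤-maxWhere {xs = y ∷ xs} (there x∈xs) Px with P y
  ... | true  = ≤-trans (≤-maxWhere x∈xs Px) (m≤n⊔m y _)
  ... | false = ≤-maxWhere x∈xs Px

  maxWhere-lub : ∀ {c} xs → b ≤ c → (∀ x → T (P x) → x ≤ c) → maxWhere P b xs ≤ c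
  maxWhere-lub []       b≤c ub = b≤c
  maxWhere-lub (y ∷ xs) b≤c ub with P y in Py
  ... | true  = ⊔-lub (ub y (subst T (sym Py) _)) (maxWhere-lub xs b≤c ub)
  ... | false = maxWhere-lub xs b≤c ub

  ≤-maxWhere-base : ∀ xs → b ≤ maxWhere P b xs
  ≤-maxWhere-base []       = ≤-refl
  ≤-maxWhere-base (y ∷ xs) with P y
  ... | true  = ≤-trans (≤-maxWhere-base xs) (m≤n⊔m y _)
  ... | false = ≤-maxWhere-base xs

  minWhere-≤ : ∀ {x xs} → x ∈ xs → T (P x) → minWhere P b xs ≤ x
  minWhere-≤ {xs = y ∷ xs} (here refl) Px with P y
  ... | true = m⊓n≤m y _
  minWhere-≤ {xs = y ∷ xs} (there x∈xs) Px with P y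
  ... | true  = ≤-trans (m⊓n≤n y _) (minWhere-≤ x∈xs Px)
  ... | false = minWhere-≤ x∈xs Px

  minWhere-glb : ∀ {c} xs → c ≤ b → (∀ x → T (P x) → c ≤ x) → c ≤ minWhere P b xs
  minWhere-glb []       c≤b lb = c≤b
  minWhere-glb (y ∷ xs) c≤b lb with P y in Py
  ... | true  = ⊓-glb (lb y (subst T (sym Py) _)) (minWhere-glb xs c≤b lb)
  ... | false = minWhere-glb xs c≤b lb

  minWhere-≤-base : ∀ xs → minWhere P b xs ≤ b
  minWhere-≤-base []       = ≤-refl
  minWhere-≤-base (y ∷ xs) with P y
  ... | true  = ≤-trans (m⊓n≤n y _) (minWhere-≤-base xs)
  ... | false = minWhere-≤-base xs

<ᵇ′⇒< : ∀ m n → T (m <ᵇ′ n) → m < n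
<ᵇ′⇒< zero    (suc n) _ = z<s
<ᵇ′⇒< (suc m) (suc n) t = s<s (<ᵇ′⇒< m n t)

<⇒<ᵇ′ : ∀ {m n} → m < n → T (m <ᵇ′ n)
<⇒<ᵇ′ {zero}  {suc n} _         = _
<⇒<ᵇ′ {suc m} {suc n} (s<s m<n) = <⇒<ᵇ′ m<n

≤ᵇ≡true⇒≤ : ∀ {m n} → (m ≤ᵇ n) ≡ true → m ≤ n
≤ᵇ≡true⇒≤ {m} {n} e = ≤ᵇ⇒≤ m n (Equivalence.from T-≡ e)

≤ᵇ≡false⇒> : ∀ {m n} → (m ≤ᵇ n) ≡ false → n < m
≤ᵇ≡false⇒> e = ≰⇒> (λ m≤n → subst T e (≤⇒≤ᵇ m≤n))

≤⇒≤ᵇ≡true : ∀ {m n} → m ≤ n → (m ≤ᵇ n) ≡ true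
≤⇒≤ᵇ≡true m≤n = Equivalence.to T-≡ (≤⇒≤ᵇ m≤n)

>⇒≤ᵇ≡false : ∀ {m n} → n < m → (m ≤ᵇ n) ≡ false
>⇒≤ᵇ≡false {m} {n} n<m with m ≤ᵇ n in e
... | false = refl
... | true  = ⊥-elim (<⇒≱ n<m (≤ᵇ≡true⇒≤ e))

memℕ-zero : ∀ {n} (A : Subset n) → memℕ A 0 ≡ false
memℕ-zero []      = refl
memℕ-zero (_ ∷ _) = refl

∈-range : ∀ {n j} → 1 ≤ j → j ≤ suc n → j ∈ range 1 (suc n)
∈-range {j = suc t} _ t<1+n = ∈-map⁺ (1 +_) (∈-upTo⁺ t<1+n)

module _ {n} (A B : Subset n) (k : ℕ) where

  private
    splitᵖ : ∀ {j} → T (j <ᵇ′ k ∧ not (memℕ A j) ∧ memℕ B (j ∸ 1)) →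
             j < k × memℕ A j ≡ false × memℕ B (j ∸ 1) ≡ true
    splitᵖ {j} t with Equivalence.to T-∧ t
    ... | j<k , t′ with Equivalence.to T-∧ t′
    ...   | j∉A , j-1∈B = <ᵇ′⇒< j k j<k , Equivalence.to T-not-≡ j∉A , Equivalence.to T-≡ j-1∈B

    splitᵠ : ∀ {j} → T (k <ᵇ′ j ∧ memℕ B j ∧ not (memℕ A (j ∸ 1))) →
             k < j × memℕ B j ≡ true × memℕ A (j ∸ 1) ≡ false
    splitᵠ {j} t with Equivalence.to T-∧ t
    ... | k<j , t′ with Equivalence.to T-∧ t′
    ...   | j∈B , j-1∉A = <ᵇ′⇒< k j k<j , Equivalence.to T-≡ j∈B , Equivalence.to T-not-≡ j-1∉A

  1≤pIdx : 1 ≤ pIdx A B k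
  1≤pIdx = ≤-maxWhere-base _ 1 (range 1 (suc n))

  ≤-pIdx : ∀ {J} → suc (suc J) ≤ suc n → suc (suc J) < k →
           memℕ A (suc (suc J)) ≡ false → memℕ B (suc J) ≡ true → suc (suc J) ≤ pIdx A B k
  ≤-pIdx j≤n+1 j<k j∉A j-1∈B = ≤-maxWhere _ 1 (∈-range (s≤s z≤n) j≤n+1)
    (Equivalence.from T-∧ (<⇒<ᵇ′ j<k ,
      Equivalence.from T-∧ (Equivalence.from T-not-≡ j∉A , Equivalence.from T-≡ j-1∈B)))

  pIdx-≤ : ∀ {c} → 1 ≤ c →
           (∀ j → j < k → memℕ A j ≡ false → memℕ B (j ∸ 1) ≡ true → j ≤ c) → pIdx A B k ≤ c
  pIdx-≤ 1≤c ub = maxWhere-lub _ 1 (range 1 (suc n)) 1≤c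
    (λ j t → let (j<k , j∉A , j-1∈B) = splitᵖ t in ub j j<k j∉A j-1∈B)

  qIdx≤1+n : qIdx A B k ≤ suc n
  qIdx≤1+n = minWhere-≤-base _ (suc n) (range 1 (suc n))

  qIdx-≤ : ∀ {J} → suc (suc J) ≤ suc n → k < suc (suc J) →
           memℕ B (suc (suc J)) ≡ true → memℕ A (suc J) ≡ false → qIdx A B k ≤ suc (suc J)
  qIdx-≤ j≤n+1 k<j j∈B j-1∉A = minWhere-≤ _ (suc n) (∈-range (s≤s z≤n) j≤n+1)
    (Equivalence.from T-∧ (<⇒<ᵇ′ k<j ,
      Equivalence.from T-∧ (Equivalence.from T-≡ j∈B , Equivalence.from T-not-≡ j-1∉A)))

  ≤-qIdx : ∀ {c} → c ≤ suc n →
           (∀ j → k < j → memℕ B j ≡ true → memℕ A (j ∸ 1) ≡ false → c ≤ j) → c ≤ qIdx A B k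
  ≤-qIdx c≤n+1 lb = minWhere-glb _ (suc n) (range 1 (suc n)) c≤n+1
    (λ j t → let (k<j , j∈B , j-1∉A) = splitᵠ t in lb j k<j j∈B j-1∉A)

⊆ᵇ⇒memℕ : ∀ {n} (B A : Subset n) → T (B ⊆ᵇ A) → ∀ J → memℕ B (suc J) ≡ true → memℕ A (suc J) ≡ true
⊆ᵇ⇒memℕ (true ∷ B)  (true ∷ A)  _   zero    _ = refl
⊆ᵇ⇒memℕ (true ∷ B)  (true ∷ A)  B⊆A (suc J) e = ⊆ᵇ⇒memℕ B A B⊆A J e
⊆ᵇ⇒memℕ (false ∷ B) (_ ∷ A)     B⊆A (suc J) e = ⊆ᵇ⇒memℕ B A B⊆A J e
⊆ᵇ⇒memℕ (true ∷ B)  (false ∷ A) ()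

memℕ⇒⊆ᵇ : ∀ {n} (B A : Subset n) → (∀ J → memℕ B (suc J) ≡ true → memℕ A (suc J) ≡ true) → T (B ⊆ᵇ A)
memℕ⇒⊆ᵇ []          []          _ = tt
memℕ⇒⊆ᵇ (false ∷ B) (_ ∷ A)     h = memℕ⇒⊆ᵇ B A (h ∘ suc)
memℕ⇒⊆ᵇ (true ∷ B)  (true ∷ A)  h = memℕ⇒⊆ᵇ B A (h ∘ suc)
memℕ⇒⊆ᵇ (true ∷ B)  (false ∷ A) h with h zero refl
... | ()

memℕ⇒< : ∀ {n} (A : Subset n) {J} → memℕ A (suc J) ≡ true → J < n
memℕ⇒< (_ ∷ _) {zero}  _ = z<s
memℕ⇒< (_ ∷ A) {suc J} e = s<s (memℕ⇒< A e)

module _ {n} {B A : Subset n} {i k : ℕ} (compat : Compatible (B , i) (A , k)) where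

  compatible-⊆ : ∀ J → memℕ B (suc J) ≡ true → memℕ A (suc J) ≡ false → ⊥
  compatible-⊆ J J∈B J∉A with trans (sym (⊆ᵇ⇒memℕ B A (Compatible.subset compat) J J∈B)) J∉A
  ... | ()

  compatible-↘ : ∀ J → suc J < n → memℕ B (suc J) ≡ true → i ≤ suc J →
                 memℕ A (suc (suc J)) ≡ false → suc (suc J) < k → ⊥
  compatible-↘ J J+1<n J+1∈B i≤J+1 J+2∉A J+2<k =
    1+n≰n (≤-trans (≤-pIdx A B k (m≤n⇒m≤1+n J+1<n) J+2<k J+2∉A J+1∈B)
                   (≤-trans (proj₁ (Compatible.bounded compat)) i≤J+1))

  compatible-↙ : ∀ J → suc J < n → memℕ B (suc (suc J)) ≡ true → suc (suc J) < i →
                 memℕ A (suc J) ≡ false → k ≤ suc J → ⊥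
  compatible-↙ J J+1<n J+2∈B J+2<i J+1∉A k≤J+1 =
    1+n≰n (≤-trans J+2<i (≤-trans (proj₂ (Compatible.bounded compat))
                                  (qIdx-≤ A B k (m≤n⇒m≤1+n J+1<n) (s≤s k≤J+1) J+2∈B J+1∉A)))

  compatible-range : 1 ≤ i × i ≤ suc n
  compatible-range = ≤-trans (1≤pIdx A B k) (proj₁ (Compatible.bounded compat)) ,
                     ≤-trans (proj₂ (Compatible.bounded compat)) (qIdx≤1+n A B k)

-- Blocks of the board

double : ℕ → ℕ
double zero    = zero
double (suc n) = suc (suc (double n))

double≡2* : ∀ n → double n ≡ 2 * n
double≡2* zero    = refl
double≡2* (suc n) = cong suc (trans (cong suc (double≡2* n)) (sym (+-suc n (n + 0))))

isOdd : ℕ → Bool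
isOdd zero          = false
isOdd (suc zero)    = true
isOdd (suc (suc n)) = isOdd n

-- coord I ρ = 2I + [ρ], the lower (or right) half of block I when ρ = true
coord : ℕ → Bool → ℕ
coord zero    false = 0
coord zero    true  = 1
coord (suc I) ρ     = suc (suc (coord I ρ))

⌊coord/2⌋≡ : ∀ I ρ → ⌊ coord I ρ /2⌋ ≡ I
⌊coord/2⌋≡ zero    false = refl
⌊coord/2⌋≡ zero    true  = refl
⌊coord/2⌋≡ (suc I) ρ     = cong suc (⌊coord/2⌋≡ I ρ)

isOdd-coord : ∀ I ρ → isOdd (coord I ρ) ≡ ρ
isOdd-coord zero    false = refl
isOdd-coord zero    true  = refl
isOdd-coord (suc I) ρ     = isOdd-coord I ρ

coord-⌊/2⌋-isOdd : ∀ i → coord ⌊ i /2⌋ (isOdd i) ≡ i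
coord-⌊/2⌋-isOdd zero          = refl
coord-⌊/2⌋-isOdd (suc zero)    = refl
coord-⌊/2⌋-isOdd (suc (suc i)) with isOdd i | coord-⌊/2⌋-isOdd i
... | false | e = cong (suc ∘ suc) e
... | true  | e = cong (suc ∘ suc) e

coord-< : ∀ {I N} ρ → I < N → coord I ρ < double N
coord-< {zero}  {suc N} false _         = s≤s z≤n
coord-< {zero}  {suc N} true  _         = s≤s (s≤s z≤n)
coord-< {suc I} {suc N} ρ     (s<s I<N) = s<s (s<s (coord-< ρ I<N))

⌊/2⌋-< : ∀ {i N} → i < double N → ⌊ i /2⌋ < N
⌊/2⌋-< {zero}        {suc N} _               = z<s
⌊/2⌋-< {suc zero}    {suc N} _               = z<s
⌊/2⌋-< {suc (suc i)} {suc N} (s<s (s<s i<N)) = s<s (⌊/2⌋-< i<N)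

∣coord-coord∣≤1 : ∀ I ρ ρ′ → ∣ coord I ρ - coord I ρ′ ∣ ≤ 1
∣coord-coord∣≤1 zero    false false = z≤n
∣coord-coord∣≤1 zero    false true  = ≤-refl
∣coord-coord∣≤1 zero    true  false = ≤-refl
∣coord-coord∣≤1 zero    true  true  = z≤n
∣coord-coord∣≤1 (suc I) ρ     ρ′    = ∣coord-coord∣≤1 I ρ ρ′

∣coord-coord-suc∣≤1 : ∀ I → ∣ coord I true - coord (suc I) false ∣ ≤ 1
∣coord-coord-suc∣≤1 zero    = ≤-refl
∣coord-coord-suc∣≤1 (suc I) = ∣coord-coord-suc∣≤1 I

adjacent-coord : ∀ I ρ I′ ρ′ → ∣ coord I ρ - coord I′ ρ′ ∣ ≤ 1 →
  I ≡ I′ ⊎ (I′ ≡ suc I × ρ ≡ true × ρ′ ≡ false) ⊎ (I ≡ suc I′ × ρ ≡ false × ρ′ ≡ true)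
adjacent-coord zero    _     zero             _     _        = inj₁ refl
adjacent-coord zero    true  (suc zero)       false _        = inj₂ (inj₁ (refl , refl , refl))
adjacent-coord zero    false (suc _)          _     (s≤s ())
adjacent-coord zero    true  (suc zero)       true  (s≤s ())
adjacent-coord zero    true  (suc (suc _))    _     (s≤s ())
adjacent-coord (suc zero)    false zero       true  _        = inj₂ (inj₂ (refl , refl , refl))
adjacent-coord (suc _)       _     zero       false (s≤s ())
adjacent-coord (suc zero)    true  zero       true  (s≤s ())
adjacent-coord (suc (suc _)) _     zero       true  (s≤s ())
adjacent-coord (suc I) ρ (suc I′) ρ′ d with adjacent-coord I ρ I′ ρ′ d
... | inj₁ e                  = inj₁ (cong suc e)
... | inj₂ (inj₁ (e , r , s)) = inj₂ (inj₁ (cong suc e , r , s))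
... | inj₂ (inj₂ (e , r , s)) = inj₂ (inj₂ (cong suc e , r , s))

coord-injectiveʳ : ∀ I {ρ ρ′} → coord I ρ ≡ coord I ρ′ → ρ ≡ ρ′
coord-injectiveʳ I {ρ} {ρ′} e = trans (sym (isOdd-coord I ρ)) (trans (cong isOdd e) (isOdd-coord I ρ′))

bit : Bool → ℕ
bit false = 0
bit true  = 1

-- the cells ↖, ↗, ↙, ↘ of a 2 × 2 block
Block : Set
Block = Bool × Bool × Bool × Bool

corner : Bool → Bool → Block → Bool
corner false false (a , _ , _ , _) = a
corner false true  (_ , b , _ , _) = b
corner true  false (_ , _ , c , _) = c
corner true  true  (_ , _ , _ , d) = d

kings : Block → ℕ
kings (a , b , c , d) = (bit a + bit b) + (bit c + bit d)

lowerHalf leftHalf : Block → Bool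
lowerHalf (_ , _ , c , d) = c ∨ d
leftHalf  (a , _ , c , _) = a ∨ c

-- the block whose only king lies in the lower half iff l and in the right half iff r
singleKing : Bool → Bool → Block
singleKing l r = does (false ≟ l) ∧ does (false ≟ r) , does (false ≟ l) ∧ does (true ≟ r)
               , does (true ≟ l)  ∧ does (false ≟ r) , does (true ≟ l)  ∧ does (true ≟ r)

corner-singleKing-self : ∀ l r → corner l r (singleKing l r) ≡ true
corner-singleKing-self false false = refl
corner-singleKing-self false true  = refl
corner-singleKing-self true  false = refl
corner-singleKing-self true  true  = refl

kings-singleKing : ∀ l r → kings (singleKing l r) ≡ 1
kings-singleKing false false = refl
kings-singleKing false true  = refl
kings-singleKing true  false = refl
kings-singleKing true  true  = refl

lowerHalf-singleKing : ∀ l r → lowerHalf (singleKing l r) ≡ l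
lowerHalf-singleKing false _     = refl
lowerHalf-singleKing true  false = refl
lowerHalf-singleKing true  true  = refl

leftHalf-singleKing : ∀ l r → leftHalf (singleKing l r) ≡ not r
leftHalf-singleKing false false = refl
leftHalf-singleKing false true  = refl
leftHalf-singleKing true  false = refl
leftHalf-singleKing true  true  = refl

data OneKing : Block → Set where
  ↖ : OneKing (true  , false , false , false)
  ↗ : OneKing (false , true  , false , false)
  ↙ : OneKing (false , false , true  , false)
  ↘ : OneKing (false , false , false , true)

oneKing : ∀ B → kings B ≡ 1 → OneKing B
oneKing (true  , false , false , false) _ = ↖
oneKing (false , true  , false , false) _ = ↗
oneKing (false , false , true  , false) _ = ↙
oneKing (false , false , false , true)  _ = ↘
oneKing (true  , true  , _     , _)     ()
oneKing (true  , false , true  , _)     ()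
oneKing (true  , false , false , true)  ()
oneKing (false , true  , true  , _)     ()
oneKing (false , true  , false , true)  ()
oneKing (false , false , true  , true)  ()
oneKing (false , false , false , false) ()

oneKing⇒singleKing : ∀ {B} → OneKing B → B ≡ singleKing (lowerHalf B) (not (leftHalf B))
oneKing⇒singleKing ↖ = refl
oneKing⇒singleKing ↗ = refl
oneKing⇒singleKing ↙ = refl
oneKing⇒singleKing ↘ = refl

atMostOneKing : ∀ B → (∀ {ρ γ ρ′ γ′} → ¬ (ρ ≡ ρ′ × γ ≡ γ′) → corner ρ γ B ≡ true → corner ρ′ γ′ B ≡ true → ⊥) →
                kings B ≤ 1
atMostOneKing (false , false , false , false) _ = z≤n
atMostOneKing (true  , false , false , false) _ = ≤-refl
atMostOneKing (false , true  , false , false) _ = ≤-refl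
atMostOneKing (false , false , true  , false) _ = ≤-refl
atMostOneKing (false , false , false , true)  _ = ≤-refl
atMostOneKing (true  , true  , _     , _)     apart = ⊥-elim (apart {false} {false} {false} {true} (λ { (_ , ()) }) refl refl)
atMostOneKing (true  , _     , true  , _)     apart = ⊥-elim (apart {false} {false} {true}  {false} (λ { (() , _) }) refl refl)
atMostOneKing (true  , _     , _     , true)  apart = ⊥-elim (apart {false} {false} {true}  {true}  (λ { (() , _) }) refl refl)
atMostOneKing (_     , true  , true  , _)     apart = ⊥-elim (apart {false} {true}  {true}  {false} (λ { (() , _) }) refl refl)
atMostOneKing (_     , true  , _     , true)  apart = ⊥-elim (apart {false} {true}  {true}  {true}  (λ { (() , _) }) refl refl)
atMostOneKing (_     , _     , true  , true)  apart = ⊥-elim (apart {true}  {false} {true}  {true}  (λ { (_ , ()) }) refl refl)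

∑< : ℕ → (ℕ → ℕ) → ℕ
∑< zero    f = 0
∑< (suc n) f = f 0 + ∑< n (f ∘ suc)

∑<-cong : ∀ n {f g : ℕ → ℕ} → (∀ {x} → x < n → f x ≡ g x) → ∑< n f ≡ ∑< n g
∑<-cong zero    eq = refl
∑<-cong (suc n) eq = cong₂ _+_ (eq z<s) (∑<-cong n (eq ∘ s<s))

∑<-distrib-+ : ∀ n (f g : ℕ → ℕ) → ∑< n (λ x → f x + g x) ≡ ∑< n f + ∑< n g
∑<-distrib-+ zero    f g = refl
∑<-distrib-+ (suc n) f g = begin
  (f 0 + g 0) + ∑< n (λ x → f (suc x) + g (suc x))   ≡⟨ cong ((f 0 + g 0) +_) (∑<-distrib-+ n (f ∘ suc) (g ∘ suc)) ⟩
  (f 0 + g 0) + (∑< n (f ∘ suc) + ∑< n (g ∘ suc))    ≡⟨ interchange (f 0) (g 0) _ _ ⟩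
  (f 0 + ∑< n (f ∘ suc)) + (g 0 + ∑< n (g ∘ suc))    ∎
  where open ≡-Reasoning

∑<-const : ∀ n c → ∑< n (λ _ → c) ≡ n * c
∑<-const zero    c = refl
∑<-const (suc n) c = cong (c +_) (∑<-const n c)

∑<-≤ : ∀ n {f : ℕ → ℕ} {c} → (∀ {x} → x < n → f x ≤ c) → ∑< n f ≤ n * c
∑<-≤ zero    ub = z≤n
∑<-≤ (suc n) ub = +-mono-≤ (ub z<s) (∑<-≤ n (ub ∘ s<s))

+-≡-+⇒≡ : ∀ {a b c d} → a ≤ c → b ≤ d → a + b ≡ c + d → a ≡ c × b ≡ d
+-≡-+⇒≡ {a} {b} {c} {d} a≤c b≤d eq with m≤n⇒m<n∨m≡n a≤c
... | inj₁ a<c = ⊥-elim (<-irrefl eq (+-mono-<-≤ a<c b≤d))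
... | inj₂ refl = refl , +-cancelˡ-≡ a b d eq

∑<-≡*⇒≡ : ∀ n {f : ℕ → ℕ} {c} → (∀ {x} → x < n → f x ≤ c) → ∑< n f ≡ n * c → ∀ {x} → x < n → f x ≡ c
∑<-≡*⇒≡ (suc n) ub eq {zero}  _         = proj₁ (+-≡-+⇒≡ (ub z<s) (∑<-≤ n (ub ∘ s<s)) eq)
∑<-≡*⇒≡ (suc n) ub eq {suc x} (s<s x<n) =
  ∑<-≡*⇒≡ n (ub ∘ s<s) (proj₂ (+-≡-+⇒≡ (ub z<s) (∑<-≤ n (ub ∘ s<s)) eq)) x<n

∑<-double : ∀ N (f : ℕ → ℕ) → ∑< (double N) f ≡ ∑< N (λ I → f (coord I false) + f (coord I true))
∑<-double zero    f = refl
∑<-double (suc N) f = trans (sym (+-assoc (f 0) (f 1) _)) (cong (f 0 + f 1 +_) (∑<-double N (f ∘ suc ∘ suc)))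

cell : ∀ {m n} → Vec (Vec Bool m) n → ℕ → ℕ → Bool
cell {m} M i j = lookupℕ false (lookupℕ (replicate m false) M i) j

lookup²≡cell : ∀ {m n} (M : Vec (Vec Bool m) n) a b → lookup (lookup M a) b ≡ cell M (toℕ a) (toℕ b)
lookup²≡cell {m} M a b = trans (lookup≡lookupℕ false (lookup M a) b)
                               (cong (λ r → lookupℕ false r (toℕ b)) (lookup≡lookupℕ (replicate m false) M a))

cell-tabulateℕ : ∀ {m n} (f : ℕ → ℕ → Bool) {i j} → i < n → j < m →
                 cell (tabulateℕ n (λ i → tabulateℕ m (f i))) i j ≡ f i j
cell-tabulateℕ {m} f {i} {j} i<n j<m =
  trans (cong (λ r → lookupℕ false r j) (lookupℕ-tabulateℕ (replicate m false) (λ i → tabulateℕ m (f i)) i<n))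
        (lookupℕ-tabulateℕ false (f i) j<m)

cell-ext : ∀ {m n} (M M′ : Vec (Vec Bool m) n) → (∀ {i j} → i < n → j < m → cell M i j ≡ cell M′ i j) → M ≡ M′
cell-ext {m} M M′ eq = lookupℕ-ext (replicate m false) M M′ (λ i<n → lookupℕ-ext false _ _ (eq i<n))

countTrue≡∑< : ∀ {m} (r : Vec Bool m) → countTrue r ≡ ∑< m (bit ∘ lookupℕ false r)
countTrue≡∑< []          = refl
countTrue≡∑< (true ∷ r)  = cong suc (countTrue≡∑< r)
countTrue≡∑< (false ∷ r) = countTrue≡∑< r

kingCount≡∑< : ∀ {m n} (M : Vec (Vec Bool m) n) → kingCount M ≡ ∑< n (λ i → ∑< m (λ j → bit (cell M i j)))
kingCount≡∑< []      = refl
kingCount≡∑< (r ∷ M) = cong₂ _+_ (countTrue≡∑< r) (kingCount≡∑< M)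

block : ∀ {m n} → Vec (Vec Bool m) n → ℕ → ℕ → Block
block M I J = cell M (coord I false) (coord J false) , cell M (coord I false) (coord J true)
            , cell M (coord I true)  (coord J false) , cell M (coord I true)  (coord J true)

corner-block : ∀ {m n} (M : Vec (Vec Bool m) n) I J ρ γ → corner ρ γ (block M I J) ≡ cell M (coord I ρ) (coord J γ)
corner-block M I J false false = refl
corner-block M I J false true  = refl
corner-block M I J true  false = refl
corner-block M I J true  true  = refl

block-ext : ∀ {N} (M M′ : Board N) → (∀ {I J} → I < N → J < N → block M I J ≡ block M′ I J) → M ≡ M′
block-ext {N} M M′ eq = cell-ext M M′ same
  where
  same : ∀ {i j} → i < 2 * N → j < 2 * N → cell M i j ≡ cell M′ i j
  same {i} {j} i< j< = begin
    cell M i j                         ≡⟨ cong₂ (cell M) (sym (coord-⌊/2⌋-isOdd i)) (sym (coord-⌊/2⌋-isOdd j)) ⟩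
    cell M (coord I ρ) (coord J γ)     ≡⟨ sym (corner-block M I J ρ γ) ⟩
    corner ρ γ (block M I J)           ≡⟨ cong (corner ρ γ) (eq (⌊/2⌋-< i<d) (⌊/2⌋-< j<d)) ⟩
    corner ρ γ (block M′ I J)          ≡⟨ corner-block M′ I J ρ γ ⟩
    cell M′ (coord I ρ) (coord J γ)    ≡⟨ cong₂ (cell M′) (coord-⌊/2⌋-isOdd i) (coord-⌊/2⌋-isOdd j) ⟩
    cell M′ i j                        ∎
    where
    open ≡-Reasoning
    i<d = subst (i <_) (sym (double≡2* N)) i<
    j<d = subst (j <_) (sym (double≡2* N)) j<
    I = ⌊ i /2⌋
    J = ⌊ j /2⌋
    ρ = isOdd i
    γ = isOdd j

kingCount≡∑kings : ∀ N (M : Board N) → kingCount M ≡ ∑< N (λ I → ∑< N (λ J → kings (block M I J)))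
kingCount≡∑kings N M = begin
  kingCount M
    ≡⟨ kingCount≡∑< M ⟩
  ∑< (2 * N) (λ i → ∑< (2 * N) (count i))
    ≡⟨ cong (λ L → ∑< L (λ i → ∑< L (count i))) (sym (double≡2* N)) ⟩
  ∑< (double N) (λ i → ∑< (double N) (count i))
    ≡⟨ ∑<-double N _ ⟩
  ∑< N (λ I → ∑< (double N) (count (coord I false)) + ∑< (double N) (count (coord I true)))
    ≡⟨ ∑<-cong N (λ _ → cong₂ _+_ (∑<-double N _) (∑<-double N _)) ⟩
  ∑< N (λ I → ∑< N (λ J → count (coord I false) (coord J false) + count (coord I false) (coord J true))
            + ∑< N (λ J → count (coord I true) (coord J false) + count (coord I true) (coord J true)))
    ≡⟨ ∑<-cong N (λ _ → sym (∑<-distrib-+ N _ _)) ⟩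
  ∑< N (λ I → ∑< N (λ J → kings (block M I J)))
    ∎
  where
  open ≡-Reasoning
  count : ℕ → ℕ → ℕ
  count i j = bit (cell M i j)

NonAttackingℕ : ∀ N → Board N → Set
NonAttackingℕ N M = ∀ {i j i′ j′} → i < double N → j < double N → i′ < double N → j′ < double N →
  ¬ (i ≡ i′ × j ≡ j′) → ∣ i - i′ ∣ ≤ 1 → ∣ j - j′ ∣ ≤ 1 → cell M i j ≡ true → cell M i′ j′ ≡ true → ⊥

module _ {N : ℕ} (M : Board N) where

  nonAttacking⇒ℕ : NonAttacking N M → NonAttackingℕ N M
  nonAttacking⇒ℕ nonAttacking {i} {j} {i′} {j′} i< j< i′< j′< distinct row col occ occ′ =
    nonAttacking (fin i<) (fin j<) (fin i′<) (fin j′<) attacking (occupied i< j< occ) (occupied i′< j′< occ′)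
    where
    fin : ∀ {x} → x < double N → Fin (2 * N)
    fin {x} x< = fromℕ< (subst (x <_) (double≡2* N) x<)
    toℕ-fin : ∀ {x} (x< : x < double N) → toℕ (fin x<) ≡ x
    toℕ-fin {x} x< = toℕ-fromℕ< (subst (x <_) (double≡2* N) x<)
    occupied : ∀ {x y} (x< : x < double N) (y< : y < double N) → cell M x y ≡ true → Occupied N M (fin x<) (fin y<)
    occupied x< y< occ =
      trans (lookup²≡cell M _ _) (subst₂ (λ x y → cell M x y ≡ true) (sym (toℕ-fin x<)) (sym (toℕ-fin y<)) occ)
    attacking : Attacking (fin i<) (fin j<) (fin i′<) (fin j′<)
    attacking = (λ (a≡a′ , b≡b′) → distinct ( trans (sym (toℕ-fin i<)) (trans (cong toℕ a≡a′) (toℕ-fin i′<))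
                                            , trans (sym (toℕ-fin j<)) (trans (cong toℕ b≡b′) (toℕ-fin j′<))))
              , subst₂ (λ x y → ∣ x - y ∣ ≤ 1) (sym (toℕ-fin i<)) (sym (toℕ-fin i′<)) row
              , subst₂ (λ x y → ∣ x - y ∣ ≤ 1) (sym (toℕ-fin j<)) (sym (toℕ-fin j′<)) col

  nonAttacking⇐ℕ : NonAttackingℕ N M → NonAttacking N M
  nonAttacking⇐ℕ nonAttacking a b a′ b′ (distinct , row , col) occ occ′ =
    nonAttacking (bound a) (bound b) (bound a′) (bound b′)
      (λ (a≡a′ , b≡b′) → distinct (toℕ-injective a≡a′ , toℕ-injective b≡b′)) row col
      (trans (sym (lookup²≡cell M a b)) occ) (trans (sym (lookup²≡cell M a′ b′)) occ′)
    where
    bound : (x : Fin (2 * N)) → toℕ x < double N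
    bound x = subst (toℕ x <_) (sym (double≡2* N)) (toℕ<n x)

-- The board of a sequence of states

module Configuration {N : ℕ} (st : ℕ → State N) where

  lower right : ℕ → ℕ → Bool
  lower I J = memℕ (proj₁ (st I)) (suc J)
  right I J = proj₂ (st I) ≤ᵇ suc J

  kingRow kingCol : ℕ → ℕ → ℕ
  kingRow I J = coord I (lower I J)
  kingCol I J = coord J (right I J)

  KingsApart : Set
  KingsApart = ∀ {I J I′ J′} → I < N → J < N → I′ < N → J′ < N → ¬ (I ≡ I′ × J ≡ J′) →
               ∣ kingRow I J - kingRow I′ J′ ∣ ≤ 1 → ∣ kingCol I J - kingCol I′ J′ ∣ ≤ 1 → ⊥

  Consecutive : Set
  Consecutive = ∀ {I} → suc I < N → Compatible (st I) (st (suc I))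

  right⇒≤ : ∀ I J → right I J ≡ true → proj₂ (st I) ≤ suc J
  right⇒≤ I J = ≤ᵇ≡true⇒≤ {proj₂ (st I)}

  ¬right⇒> : ∀ I J → right I J ≡ false → suc J < proj₂ (st I)
  ¬right⇒> I J = ≤ᵇ≡false⇒> {proj₂ (st I)}

  right-step : ∀ I J → right I J ≡ true → right I (suc J) ≡ false → ⊥
  right-step I J r r′ = <⇒≱ (¬right⇒> I (suc J) r′) (m≤n⇒m≤1+n (right⇒≤ I J r))

  consecutive⇒kingsApart : Consecutive → KingsApart
  consecutive⇒kingsApart consec {I} {J} {I′} {J′} I<N J<N I′<N J′<N distinct row col
    with adjacent-coord I (lower I J) I′ (lower I′ J′) row | adjacent-coord J (right I J) J′ (right I′ J′) col
  ... | inj₁ refl | inj₁ refl = distinct (refl , refl)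
  ... | inj₁ refl | inj₂ (inj₁ (refl , r , r′)) = right-step I J r r′
  ... | inj₁ refl | inj₂ (inj₂ (refl , r , r′)) = right-step I J′ r′ r
  ... | inj₂ (inj₁ (refl , l , l′)) | inj₁ refl = compatible-⊆ (consec I′<N) J l l′
  ... | inj₂ (inj₁ (refl , l , l′)) | inj₂ (inj₁ (refl , r , r′)) =
    compatible-↘ (consec I′<N) J J′<N l (right⇒≤ I J r) l′ (¬right⇒> (suc I) J′ r′)
  ... | inj₂ (inj₁ (refl , l , l′)) | inj₂ (inj₂ (refl , r , r′)) =
    compatible-↙ (consec I′<N) J′ J<N l (¬right⇒> I J r) l′ (right⇒≤ (suc I) J′ r′)
  ... | inj₂ (inj₂ (refl , l , l′)) | inj₁ refl = compatible-⊆ (consec I<N) J l′ l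
  ... | inj₂ (inj₂ (refl , l , l′)) | inj₂ (inj₁ (refl , r , r′)) =
    compatible-↙ (consec I<N) J J′<N l′ (¬right⇒> I′ J′ r′) l (right⇒≤ I J r)
  ... | inj₂ (inj₂ (refl , l , l′)) | inj₂ (inj₂ (refl , r , r′)) =
    compatible-↘ (consec I<N) J′ J<N l′ (right⇒≤ I′ J′ r′) l (¬right⇒> I J r)

  Ranged : Set
  Ranged = ∀ {I} → I < N → 1 ≤ proj₂ (st I) × proj₂ (st I) ≤ suc N

  kingsApart⇒consecutive : KingsApart → Ranged → Consecutive
  kingsApart⇒consecutive apart ranged {I} I+1<N = compatible subset (p≤i , i≤q)
    where
    I<N : I < N
    I<N = <-trans (n<1+n I) I+1<N
    B = proj₁ (st I)
    i = proj₂ (st I)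
    A = proj₁ (st (suc I))
    k = proj₂ (st (suc I))

    clash : ∀ {J J′ γ γ′} → J < N → J′ < N → lower I J ≡ true → right I J ≡ γ →
            lower (suc I) J′ ≡ false → right (suc I) J′ ≡ γ′ → ∣ coord J γ - coord J′ γ′ ∣ ≤ 1 → ⊥
    clash {J} {J′} J<N J′<N l refl l′ refl col =
      apart I<N J<N I+1<N J′<N (λ (I≡I+1 , _) → 1+n≢n (sym I≡I+1)) row col
      where
      row : ∣ kingRow I J - kingRow (suc I) J′ ∣ ≤ 1
      row rewrite l | l′ = ∣coord-coord-suc∣≤1 I

    subset : T (B ⊆ᵇ A)
    subset = memℕ⇒⊆ᵇ B A below
      where
      below : ∀ J → lower I J ≡ true → lower (suc I) J ≡ true
      below J l with lower (suc I) J in l′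
      ... | true  = refl
      ... | false = ⊥-elim (clash J<N J<N l refl l′ refl (∣coord-coord∣≤1 J _ _))
        where J<N = memℕ⇒< B l

    p≤i : pIdx A B k ≤ i
    p≤i = pIdx-≤ A B k (proj₁ (ranged I<N)) ub
      where
      ub : ∀ j → j < k → memℕ A j ≡ false → memℕ B (j ∸ 1) ≡ true → j ≤ i
      ub zero          _   _   _     = z≤n
      ub (suc zero)    _   _   0∈B   with trans (sym (memℕ-zero B)) 0∈B
      ... | ()
      ub (suc (suc J)) j<k j∉A j-1∈B with suc (suc J) ≤? i
      ... | yes j≤i = j≤i
      ... | no  j≰i = ⊥-elim (clash (memℕ⇒< B j-1∈B) J+1<N j-1∈B (≤⇒≤ᵇ≡true (≤-pred (≰⇒> j≰i)))
                                    j∉A (>⇒≤ᵇ≡false j<k) (∣coord-coord-suc∣≤1 J))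
        where J+1<N = ≤-pred (≤-trans j<k (proj₂ (ranged I+1<N)))

    i≤q : i ≤ qIdx A B k
    i≤q = ≤-qIdx A B k (proj₂ (ranged I<N)) lb
      where
      lb : ∀ j → k < j → memℕ B j ≡ true → memℕ A (j ∸ 1) ≡ false → i ≤ j
      lb zero          k<0 _   _     = ⊥-elim (n≮0 k<0)
      lb (suc zero)    k<1 _   _     = ⊥-elim (<⇒≱ k<1 (proj₁ (ranged I+1<N)))
      lb (suc (suc J)) k<j j∈B j-1∉A with i ≤? suc (suc J)
      ... | yes i≤j = i≤j
      ... | no  i≰j = ⊥-elim (clash J+1<N (<-trans (n<1+n J) J+1<N) j∈B (>⇒≤ᵇ≡false (≰⇒> i≰j))
                                    j-1∉A (≤⇒≤ᵇ≡true (≤-pred k<j))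
                                    (subst (_≤ 1) (∣-∣-comm (coord J true) (coord (suc J) false)) (∣coord-coord-suc∣≤1 J)))
        where J+1<N = memℕ⇒< B j∈B

  occupied : ℕ → ℕ → Bool
  occupied i j = does (isOdd i ≟ lower ⌊ i /2⌋ ⌊ j /2⌋) ∧ does (isOdd j ≟ right ⌊ i /2⌋ ⌊ j /2⌋)

  occupied-coord : ∀ I J ρ γ → occupied (coord I ρ) (coord J γ) ≡ does (ρ ≟ lower I J) ∧ does (γ ≟ right I J)
  occupied-coord I J ρ γ rewrite isOdd-coord I ρ | isOdd-coord J γ | ⌊coord/2⌋≡ I ρ | ⌊coord/2⌋≡ J γ = refl

  occupied-king : ∀ I J → occupied (kingRow I J) (kingCol I J) ≡ true
  occupied-king I J = trans (occupied-coord I J _ _)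
    (cong₂ _∧_ (dec-true (lower I J ≟ lower I J) refl) (dec-true (right I J ≟ right I J) refl))

  occupied⇒king : ∀ i j → occupied i j ≡ true → i ≡ kingRow ⌊ i /2⌋ ⌊ j /2⌋ × j ≡ kingCol ⌊ i /2⌋ ⌊ j /2⌋
  occupied⇒king i j occ with isOdd i ≟ lower ⌊ i /2⌋ ⌊ j /2⌋ | isOdd j ≟ right ⌊ i /2⌋ ⌊ j /2⌋
  ... | yes ρ≡ | yes γ≡ = trans (sym (coord-⌊/2⌋-isOdd i)) (cong (coord _) ρ≡) ,
                          trans (sym (coord-⌊/2⌋-isOdd j)) (cong (coord _) γ≡)
  occupied⇒king i j () | no _  | _
  occupied⇒king i j () | yes _ | no _

  board : Board N
  board = tabulateℕ (2 * N) (λ i → tabulateℕ (2 * N) (occupied i))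

  cell-board : ∀ {i j} → i < double N → j < double N → cell board i j ≡ occupied i j
  cell-board i< j< = cell-tabulateℕ occupied (subst (_ <_) (double≡2* N) i<) (subst (_ <_) (double≡2* N) j<)

  cell-board-coord : ∀ {I J} → I < N → J < N → ∀ ρ γ →
                  cell board (coord I ρ) (coord J γ) ≡ does (ρ ≟ lower I J) ∧ does (γ ≟ right I J)
  cell-board-coord {I} {J} I<N J<N ρ γ = trans (cell-board (coord-< ρ I<N) (coord-< γ J<N)) (occupied-coord I J ρ γ)

  kingsApart⇒nonAttacking : KingsApart → NonAttackingℕ N board
  kingsApart⇒nonAttacking apart {i} {j} {i′} {j′} i< j< i′< j′< distinct row col occ occ′ =
    apart (⌊/2⌋-< i<) (⌊/2⌋-< j<) (⌊/2⌋-< i′<) (⌊/2⌋-< j′<) sameBlock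
      (subst₂ (λ x y → ∣ x - y ∣ ≤ 1) i≡ i′≡ row) (subst₂ (λ x y → ∣ x - y ∣ ≤ 1) j≡ j′≡ col)
    where
    king = occupied⇒king i j (trans (sym (cell-board i< j<)) occ)
    king′ = occupied⇒king i′ j′ (trans (sym (cell-board i′< j′<)) occ′)
    i≡ = proj₁ king
    j≡ = proj₂ king
    i′≡ = proj₁ king′
    j′≡ = proj₂ king′
    sameBlock : ¬ (⌊ i /2⌋ ≡ ⌊ i′ /2⌋ × ⌊ j /2⌋ ≡ ⌊ j′ /2⌋)
    sameBlock (I≡ , J≡) = distinct
      ( trans i≡ (trans (cong₂ kingRow I≡ J≡) (sym i′≡))
      , trans j≡ (trans (cong₂ kingCol I≡ J≡) (sym j′≡)))

  nonAttacking⇒kingsApart : NonAttackingℕ N board → KingsApart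
  nonAttacking⇒kingsApart nonAttacking {I} {J} {I′} {J′} I< J< I′< J′< distinct row col =
    nonAttacking (coord-< _ I<) (coord-< _ J<) (coord-< _ I′<) (coord-< _ J′<) sameCell row col
      (trans (cell-board (coord-< _ I<) (coord-< _ J<)) (occupied-king I J))
      (trans (cell-board (coord-< _ I′<) (coord-< _ J′<)) (occupied-king I′ J′))
    where
    sameCell : ¬ (kingRow I J ≡ kingRow I′ J′ × kingCol I J ≡ kingCol I′ J′)
    sameCell (r≡ , c≡) = distinct
      ( trans (sym (⌊coord/2⌋≡ I _)) (trans (cong ⌊_/2⌋ r≡) (⌊coord/2⌋≡ I′ _))
      , trans (sym (⌊coord/2⌋≡ J _)) (trans (cong ⌊_/2⌋ c≡) (⌊coord/2⌋≡ J′ _)))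

  block-board : ∀ {I J} → I < N → J < N → block board I J ≡ singleKing (lower I J) (right I J)
  block-board I<N J<N = cong₂ _,_ (c false false) (cong₂ _,_ (c false true) (cong₂ _,_ (c true false) (c true true)))
    where c = cell-board-coord I<N J<N

  kings-board : ∀ {I J} → I < N → J < N → kings (block board I J) ≡ 1
  kings-board {I} {J} I<N J<N = trans (cong kings (block-board I<N J<N)) (kings-singleKing (lower I J) (right I J))

  kingCount-board : kingCount board ≡ N * N
  kingCount-board = begin
    kingCount board                                     ≡⟨ kingCount≡∑kings N board ⟩
    ∑< N (λ I → ∑< N (λ J → kings (block board I J)))   ≡⟨ ∑<-cong N (λ I<N → ∑<-cong N (kings-board I<N)) ⟩
    ∑< N (λ _ → ∑< N (λ _ → 1))                         ≡⟨ ∑<-cong N (λ _ → trans (∑<-const N 1) (*-identityʳ N)) ⟩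
    ∑< N (λ _ → N)                                      ≡⟨ ∑<-const N N ⟩
    N * N                                               ∎
    where open ≡-Reasoning

  consecutive⇒maxArrangement : Consecutive → MaxArrangement N board
  consecutive⇒maxArrangement consecutive =
    kingCount-board , nonAttacking⇐ℕ board (kingsApart⇒nonAttacking (consecutive⇒kingsApart consecutive))

board-cong : ∀ {N} {st st′ : ℕ → State N} → (∀ {I} → I < N → st I ≡ st′ I) →
             Configuration.board st ≡ Configuration.board st′
board-cong {N} {st} {st′} eq = block-ext _ _ λ {I} {J} I<N J<N →
  trans (Configuration.block-board st I<N J<N)
        (trans (cong (λ s → singleKing (memℕ (proj₁ s) (suc J)) (proj₂ s ≤ᵇ suc J)) (eq I<N))
               (sym (Configuration.block-board st′ I<N J<N)))

-- The states of a maximum arrangement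

PrefixClosed : ℕ → (ℕ → Bool) → Set
PrefixClosed n f = ∀ {J} → suc J < n → f (suc J) ≡ true → f J ≡ true

prefixClosed-false : ∀ {n f} → PrefixClosed n f → f 0 ≡ false → ∀ {x} → x < n → f x ≡ false
prefixClosed-false {f = f} closed f0 {zero}  _   = f0
prefixClosed-false {f = f} closed f0 {suc x} x<n with f (suc x) in fx
... | false = refl
... | true  = trans (sym (closed x<n fx)) (prefixClosed-false closed f0 (<-trans (n<1+n x) x<n))

prefix-count : ∀ n (f : ℕ → Bool) → PrefixClosed n f → ∀ {J} → J < n → (suc (∑< n (bit ∘ f)) ≤ᵇ suc J) ≡ not (f J)
prefix-count (suc n) f closed {J} J<n with f 0 in f0
... | false rewrite ∑<-cong n (λ x<n → cong bit (prefixClosed-false closed f0 (s<s x<n)))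
                  | ∑<-const n 0 | *-zeroʳ n | prefixClosed-false closed f0 J<n = refl
prefix-count (suc n) f closed {zero}  _         | true = sym (cong not f0)
prefix-count (suc n) f closed {suc J} (s<s J<n) | true =
  prefix-count n (f ∘ suc) (λ J+1<n → closed (s<s J+1<n)) J<n

count-<ᵇ : ∀ n k → k ≤ n → ∑< n (λ J → bit (not (suc k ≤ᵇ suc J))) ≡ k
count-<ᵇ zero    zero    _         = refl
count-<ᵇ (suc n) zero    _         = trans (∑<-const n 0) (*-zeroʳ n)
count-<ᵇ (suc n) (suc k) (s≤s k≤n) = cong suc (count-<ᵇ n k k≤n)

module FromBoard {N : ℕ} (M : Board N) where

  kingBelow kingLeft : ℕ → ℕ → Bool
  kingBelow I J = lowerHalf (block M I J)
  kingLeft  I J = leftHalf (block M I J)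

  stateOf : ℕ → State N
  stateOf I = tabulateℕ N (kingBelow I) , suc (∑< N (bit ∘ kingLeft I))

  open Configuration stateOf

  ranged : Ranged
  ranged {I} _ = s≤s z≤n , s≤s (subst (∑< N (bit ∘ kingLeft I) ≤_) (*-identityʳ N) (∑<-≤ N (λ _ → bit≤1 _)))
    where
    bit≤1 : ∀ b → bit b ≤ 1
    bit≤1 false = z≤n
    bit≤1 true  = ≤-refl

  lower≡kingBelow : ∀ I {J} → J < N → lower I J ≡ kingBelow I J
  lower≡kingBelow I {J} J<N = trans (memℕ≡lookupℕ (proj₁ (stateOf I)) J) (lookupℕ-tabulateℕ false (kingBelow I) J<N)

  module _ (max : MaxArrangement N M) where

    nonAttacking : NonAttackingℕ N M
    nonAttacking = nonAttacking⇒ℕ M (proj₂ max)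

    kings≤1 : ∀ {I J} → I < N → J < N → kings (block M I J) ≤ 1
    kings≤1 {I} {J} I<N J<N = atMostOneKing (block M I J) λ {ρ} {γ} {ρ′} {γ′} distinct king king′ →
      nonAttacking (coord-< ρ I<N) (coord-< γ J<N) (coord-< ρ′ I<N) (coord-< γ′ J<N)
        (λ (r≡ , c≡) → distinct (coord-injectiveʳ I r≡ , coord-injectiveʳ J c≡))
        (∣coord-coord∣≤1 I ρ ρ′) (∣coord-coord∣≤1 J γ γ′)
        (trans (sym (corner-block M I J ρ γ)) king) (trans (sym (corner-block M I J ρ′ γ′)) king′)

    kings≡1 : ∀ {I J} → I < N → J < N → kings (block M I J) ≡ 1
    kings≡1 I<N = ∑<-≡*⇒≡ N (kings≤1 I<N) (trans (rowCount I<N) (sym (*-identityʳ N)))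
      where
      rowCount : ∀ {I} → I < N → ∑< N (λ J → kings (block M I J)) ≡ N
      rowCount = ∑<-≡*⇒≡ N
        (λ {I} I<N → subst (∑< N (λ J → kings (block M I J)) ≤_) (*-identityʳ N) (∑<-≤ N (kings≤1 I<N)))
        (trans (sym (kingCount≡∑kings N M)) (proj₁ max))

    block≡singleKing : ∀ {I J} → I < N → J < N → block M I J ≡ singleKing (kingBelow I J) (not (kingLeft I J))
    block≡singleKing I<N J<N = oneKing⇒singleKing (oneKing _ (kings≡1 I<N J<N))

    king-occupied : ∀ {I J} → I < N → J < N → cell M (coord I (kingBelow I J)) (coord J (not (kingLeft I J))) ≡ true
    king-occupied {I} {J} I<N J<N =
      trans (sym (corner-block M I J l r))
            (trans (cong (corner l r) (block≡singleKing I<N J<N)) (corner-singleKing-self l r))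
      where
      l = kingBelow I J
      r = not (kingLeft I J)

    kingLeft-prefixClosed : ∀ {I} → I < N → PrefixClosed N (kingLeft I)
    kingLeft-prefixClosed {I} I<N {J} J+1<N left′ with kingLeft I J in left
    ... | true  = refl
    ... | false = ⊥-elim (nonAttacking (coord-< _ I<N) (coord-< true J<N) (coord-< _ I<N) (coord-< false J+1<N)
                            distinct (∣coord-coord∣≤1 I _ _) (∣coord-coord-suc∣≤1 J) king king′)
      where
      J<N = <-trans (n<1+n J) J+1<N
      king : cell M (coord I (kingBelow I J)) (coord J true) ≡ true
      king = subst (λ x → cell M (coord I (kingBelow I J)) (coord J (not x)) ≡ true) left (king-occupied I<N J<N)
      king′ : cell M (coord I (kingBelow I (suc J))) (coord (suc J) false) ≡ true
      king′ = subst (λ x → cell M (coord I (kingBelow I (suc J))) (coord (suc J) (not x)) ≡ true) left′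
                    (king-occupied I<N J+1<N)
      distinct : ¬ (coord I (kingBelow I J) ≡ coord I (kingBelow I (suc J)) × coord J true ≡ coord (suc J) false)
      distinct (_ , c≡) with trans (sym (isOdd-coord J true)) (trans (cong isOdd c≡) (isOdd-coord (suc J) false))
      ... | ()

    right≡not-kingLeft : ∀ {I J} → I < N → J < N → right I J ≡ not (kingLeft I J)
    right≡not-kingLeft {I} I<N = prefix-count N (kingLeft I) (kingLeft-prefixClosed I<N)

    board≡M : board ≡ M
    board≡M = block-ext board M λ {I} {J} I<N J<N → begin
      block board I J                                  ≡⟨ block-board I<N J<N ⟩
      singleKing (lower I J) (right I J)               ≡⟨ cong₂ singleKing (lower≡kingBelow I J<N)
                                                                         (right≡not-kingLeft I<N J<N) ⟩
      singleKing (kingBelow I J) (not (kingLeft I J))  ≡⟨ sym (block≡singleKing I<N J<N) ⟩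
      block M I J                                      ∎
      where open ≡-Reasoning

    consecutive : Consecutive
    consecutive = kingsApart⇒consecutive
      (nonAttacking⇒kingsApart (subst (NonAttackingℕ N) (sym board≡M) nonAttacking)) ranged

module _ {N : ℕ} (st : ℕ → State N) (ranged : Configuration.Ranged st) where
  open Configuration st
  private module Read = FromBoard {N} board

  stateOf-board : ∀ {I} → I < N → Read.stateOf I ≡ st I
  stateOf-board {I} I<N = cong₂ _,_ lowerHalves leftHalves
    where
    lowerHalves : tabulateℕ N (Read.kingBelow I) ≡ proj₁ (st I)
    lowerHalves = lookupℕ-ext false _ _ λ {J} J<N → begin
      lookupℕ false (tabulateℕ N (Read.kingBelow I)) J      ≡⟨ lookupℕ-tabulateℕ false (Read.kingBelow I) J<N ⟩
      lowerHalf (block board I J)                           ≡⟨ cong lowerHalf (block-board I<N J<N) ⟩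
      lowerHalf (singleKing (lower I J) (right I J))        ≡⟨ lowerHalf-singleKing (lower I J) (right I J) ⟩
      lower I J                                             ≡⟨ memℕ≡lookupℕ (proj₁ (st I)) J ⟩
      lookupℕ false (proj₁ (st I)) J                        ∎
      where open ≡-Reasoning

    leftHalves : suc (∑< N (bit ∘ Read.kingLeft I)) ≡ proj₂ (st I)
    leftHalves with proj₂ (st I) in k≡ | ranged I<N
    ... | suc k | _ , k≤N+1 = cong suc (trans (∑<-cong N left) (count-<ᵇ N k (≤-pred k≤N+1)))
      where
      left : ∀ {J} → J < N → bit (Read.kingLeft I J) ≡ bit (not (suc k ≤ᵇ suc J))
      left {J} J<N = cong bit (begin
        leftHalf (block board I J)                          ≡⟨ cong leftHalf (block-board I<N J<N) ⟩
        leftHalf (singleKing (lower I J) (right I J))       ≡⟨ leftHalf-singleKing (lower I J) (right I J) ⟩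
        not (right I J)                                     ≡⟨ cong (λ k′ → not (k′ ≤ᵇ suc J)) k≡ ⟩
        not (suc k ≤ᵇ suc J)                                ∎)
        where open ≡-Reasoning

∸≡suc∸suc : ∀ {m n} → m < n → n ∸ m ≡ suc (n ∸ suc m)
∸≡suc∸suc {zero}  {suc n} _         = refl
∸≡suc∸suc {suc m} {suc n} (s<s m<n) = ∸≡suc∸suc m<n

module _ (n : ℕ) where

  private
    N = suc n
    -- junk default for lookupℕ; only positions below N are ever read
    d : State N
    d = replicate N false , 0

  -- a column lists the states of the block rows from the bottom up
  rowsOf : Vec (State N) N → ℕ → State N
  rowsOf v I = lookupℕ d v (n ∸ I)

  columnOf : (ℕ → State N) → Vec (State N) N
  columnOf st = tabulateℕ N (λ t → st (n ∸ t))

  rowsOf-columnOf : ∀ st {I} → I < N → rowsOf (columnOf st) I ≡ st I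
  rowsOf-columnOf st {I} (s≤s I≤n) =
    trans (lookupℕ-tabulateℕ d (λ t → st (n ∸ t)) (s≤s (m∸n≤m n I))) (cong st (m∸[m∸n]≡n I≤n))

  columnOf-rowsOf : ∀ v → columnOf (rowsOf v) ≡ v
  columnOf-rowsOf v = lookupℕ-ext d _ v λ {t} t<N →
    trans (lookupℕ-tabulateℕ d (λ t → rowsOf v (n ∸ t)) t<N) (cong (lookupℕ d v) (m∸[m∸n]≡n (s≤s⁻¹ t<N)))

  columnOf-cong : ∀ {st st′} → (∀ {I} → I < N → st I ≡ st′ I) → columnOf st ≡ columnOf st′
  columnOf-cong {st} {st′} eq = lookupℕ-ext d _ _ λ {t} t<N →
    trans (lookupℕ-tabulateℕ d (λ t → st (n ∸ t)) t<N)
          (trans (eq (s≤s (m∸n≤m n t))) (sym (lookupℕ-tabulateℕ d (λ t → st′ (n ∸ t)) t<N)))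

  isColumn⇒consecutive : ∀ v → IsColumn v → Configuration.Consecutive (rowsOf v)
  isColumn⇒consecutive (s ∷ w) (_ , chain) {I} (s<s I<n) =
    subst (λ x → Compatible (lookupℕ d (s ∷ w) x) (rowsOf (s ∷ w) (suc I))) (sym (∸≡suc∸suc I<n))
          (isChain⇒compatible d s w chain (<-≤-trans (∸-monoʳ-< (n<1+n I) I<n) (m∸n≤m n I)))

  isColumn⇒ranged : ∀ v → IsColumn v → Configuration.Ranged (rowsOf v)
  isColumn⇒ranged v column {I} I<N with m≤n⇒m<n∨m≡n (s≤s⁻¹ I<N)
  ... | inj₁ I<n  = compatible-range (isColumn⇒consecutive v column (s<s I<n))
  isColumn⇒ranged (s ∷ w) column {I} I<N | inj₂ refl rewrite n∸n≡0 n = proj₁ column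

  consecutive⇒isColumn : ∀ st → Configuration.Consecutive st → Configuration.Ranged st → IsColumn (columnOf st)
  consecutive⇒isColumn st consecutive ranged = ranged (n<1+n n) , compatible⇒isChain d (st n) _ compat
    where
    compat : ∀ {t} → t < n → Compatible (lookupℕ d (tabulateℕ n (λ t → st (n ∸ suc t))) t) (lookupℕ d (columnOf st) t)
    compat {t} t<n =
      subst₂ Compatible (sym (lookupℕ-tabulateℕ d (λ t → st (n ∸ suc t)) t<n))
                        (sym (lookupℕ-tabulateℕ d (λ t → st (n ∸ t)) (m<n⇒m<1+n t<n)))
        (subst (λ x → Compatible (st (n ∸ suc t)) (st x)) (sym (∸≡suc∸suc t<n))
               (consecutive (subst (_< N) (∸≡suc∸suc t<n) (s≤s (m∸n≤m n t)))))

  Column↔MaxArrangement : Column N ↔ [ M ∈ Board N ∣ MaxArrangement N M ]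
  Column↔MaxArrangement = mk↔ₛ′ to from to∘from from∘to
    where
    open Configuration using (board; consecutive⇒maxArrangement)
    open FromBoard using (stateOf)

    to : Column N → [ M ∈ Board N ∣ MaxArrangement N M ]
    to (v , [ column ]) = board (rowsOf v) , [ consecutive⇒maxArrangement (rowsOf v) (isColumn⇒consecutive v column) ]

    from : [ M ∈ Board N ∣ MaxArrangement N M ] → Column N
    from (M , [ max ]) = columnOf (stateOf M) ,
      [ consecutive⇒isColumn (stateOf M) (FromBoard.consecutive M max) (FromBoard.ranged M) ]

    -- equality of boards and of columns is decidable, so it can be recovered from irrelevant proofs
    to∘from : ∀ M → to (from M) ≡ M
    to∘from (M , [ max ]) = value-injective (recompute (board≟ _ M)
      (trans (board-cong (rowsOf-columnOf (stateOf M))) (FromBoard.board≡M M max)))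
      where board≟ = Vec.≡-dec (Vec.≡-dec _≟_)

    from∘to : ∀ v → from (to v) ≡ v
    from∘to (v , [ column ]) = value-injective (recompute (column≟ _ v)
      (trans (columnOf-cong (stateOf-board (rowsOf v) (isColumn⇒ranged v column))) (columnOf-rowsOf v)))
      where column≟ = Vec.≡-dec (Product.≡-dec (Vec.≡-dec _≟_) ℕ._≟_)

theorem1 : (n : ℕ) → 1 ≤ n → Fin (kingFormula n) ↔ [ M ∈ Board n ∣ MaxArrangement n M ]
theorem1 (suc n) _ = ↔-trans (kingFormula↔Column n) (Column↔MaxArrangement n)
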